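{- In any implicative structure $(\mathscr{A},\preccurlyeq,\to)$, we have: $\mathbf{I}^{\mathscr{A}}=\bigwedge_{a\in\mathscr{A}}(a\to a)$, $\mathbf{K}^{\mathscr{A}}=\bigwedge_{a,b\in\mathscr{A}}(a\to b\to a)$, $\mathbf{W}^{\mathscr{A}}=\bigwedge_{a,b\in\mathscr{A}}((a\to a\to b)\to a\to b)$, $\mathbf{B}^{\mathscr{A}}=\bigwedge_{a,b,c\in\mathscr{A}}((a\to b)\to(c\to a)\to c\to b)$, $\mathbf{C}^{\mathscr{A}}=\bigwedge_{a,b,c\in\mathscr{A}}((a\to b\to c)\to b\to a\to c)$, $\mathbf{S}^{\mathscr{A}}=\bigwedge_{a,b,c\in\mathscr{A}}((a\to b\to c)\to(a\to b)\to a\to c)$.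
   Context: An implicative structure is a complete lattice $(\mathscr{A},\preccurlyeq)$ (meets $\bigwedge$) with $\to$ anti-monotonic in its first and monotonic in its second argument, satisfying $a\to\bigwedge_{b\in B}b=\bigwedge_{b\in B}(a\to b)$ for all $B\subseteq\mathscr{A}$. Application is $ab=\bigwedge\{c\in\mathscr{A}:a\preccurlyeq(b\to c)\}$ and, for $f:\mathscr{A}\to\mathscr{A}$, abstraction is $\bigwedge_{a\in\mathscr{A}}(a\to f(a))$. Closed $\lambda$-terms with parameters in $\mathscr{A}$ are interpreted by $a^{\mathscr{A}}=a$, $(tu)^{\mathscr{A}}=t^{\mathscr{A}}u^{\mathscr{A}}$, $(\lambda x.t)^{\mathscr{A}}=\bigwedge_{a\in\mathscr{A}}(a\to(t\{x:=a\})^{\mathscr{A}})$. The combinators are $\mathbf{I}=\lambda x.x$, $\mathbf{K}=\lambda xy.x$, $\mathbf{B}=\lambda xyz.x(yz)$, $\mathbf{W}=\lambda xy.xyy$, $\mathbf{C}=\lambda xyz.xzy$, $\mathbf{S}=\lambda xyz.xz(yz)$. -}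

module Defs where

open import Level using (0ℓ)
open import Data.Product using (Σ; _×_; _,_)
open import Relation.Binary.PropositionalEquality using (_≡_)
open import Relation.Binary.Structures using (IsPartialOrder)

-- An implicative structure: a complete lattice (A, ≼) (with arbitrary meets ⋀,
-- subsets represented as predicates A → Set) together with an implication
-- ⇒ that is anti-monotone in its first and monotone in its second argument and
-- satisfies  a ⇒ ⋀ B = ⋀ { a ⇒ b | b ∈ B }.
record ImplicativeStructure : Set₁ where
  infix  4 _≼_
  infixr 5 _⇒_
  field
    Carrier        : Set
    _≼_            : Carrier → Carrier → Set
    isPartialOrder : IsPartialOrder _≡_ _≼_
    ⋀              : (Carrier → Set) → Carrier
    ⋀-lower        : ∀ (P : Carrier → Set) x → P x → ⋀ P ≼ x
    ⋀-greatest     : ∀ (P : Carrier → Set) y → (∀ x → P x → y ≼ x) → y ≼ ⋀ P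
    _⇒_            : Carrier → Carrier → Carrier
    ⇒-antitoneˡ    : ∀ {a a′ b} → a′ ≼ a → (a ⇒ b) ≼ (a′ ⇒ b)
    ⇒-monotoneʳ    : ∀ {a b b′} → b ≼ b′ → (a ⇒ b) ≼ (a ⇒ b′)
    ⇒-⋀            : ∀ (a : Carrier) (B : Carrier → Set) →
                     (a ⇒ ⋀ B) ≡ ⋀ (λ x → Σ Carrier λ b → B b × (x ≡ (a ⇒ b)))

  ⋀[_] : (I : Set) → (I → Carrier) → Carrier
  ⋀[ I ] f = ⋀ (λ x → Σ I λ i → x ≡ f i)

  ⋀² : (Carrier → Carrier → Carrier) → Carrier
  ⋀² f = ⋀ (λ x → Σ Carrier λ a → Σ Carrier λ b → x ≡ f a b)

  ⋀³ : (Carrier → Carrier → Carrier → Carrier) → Carrier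
  ⋀³ f = ⋀ (λ x → Σ Carrier λ a → Σ Carrier λ b → Σ Carrier λ c → x ≡ f a b c)

  app : Carrier → Carrier → Carrier
  app a b = ⋀ (λ c → a ≼ (b ⇒ c))

  lam : (Carrier → Carrier) → Carrier
  lam f = ⋀[ Carrier ] (λ a → a ⇒ f a)

  -- Interpretations of the combinators, obtained by unfolding the clauses
  --   a^A = a,  (t u)^A = t^A u^A,  (λx.t)^A = ⋀_a (a ⇒ (t{x:=a})^A)
  I^A : Carrier
  I^A = lam (λ x → x)

  K^A : Carrier
  K^A = lam (λ x → lam (λ y → x))

  B^A : Carrier
  B^A = lam (λ x → lam (λ y → lam (λ z → app x (app y z))))

  W^A : Carrier
  W^A = lam (λ x → lam (λ y → app (app x y) y))

  C^A : Carrier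
  C^A = lam (λ x → lam (λ y → lam (λ z → app (app x z) y)))

  S^A : Carrier
  S^A = lam (λ x → lam (λ y → lam (λ z → app (app x z) (app y z))))

module Submission where

-- Two facts about application and abstraction drive everything.
--   * Application is left adjoint to implication: a b ≼ c iff a ≼ b ⇒ c.
--   * Implication commutes with indexed meets in its second argument, so λ-abstractions
--     (which are meets) can be introduced underneath a prefix of implications.
-- From these we derive the two "typing rules" of realizability: if t ≼ a ⇒ b and u ≼ a
-- then t u ≼ b, and if f a ≼ b then λf ≼ a ⇒ b.  Each equation is then an antisymmetry:
--   (≼)  the combinator has every instance of its type, by a typing derivation;
--   (≽)  the meet of the instances lies below the combinator, by instantiating the type
--        variables with the parameters x, y, z and the applications built from them.

open import Defs
open import Data.Product using (_×_; _,_)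
open import Relation.Binary.PropositionalEquality using (_≡_; refl; subst; sym)
open import Relation.Binary.Structures using (IsPartialOrder)

module Combinators (𝒜 : ImplicativeStructure) where
  open ImplicativeStructure 𝒜
  open IsPartialOrder isPartialOrder using (antisym) renaming (refl to ≼-refl; trans to ≼-trans)

  infixr 3 _∙_

  _∙_ : ∀ {x y z} → x ≼ y → y ≼ z → x ≼ z
  _∙_ = ≼-trans

  ⋀[]-lower : ∀ {I : Set} (f : I → Carrier) i → ⋀[ I ] f ≼ f i
  ⋀[]-lower f i = ⋀-lower _ _ (i , refl)

  ⋀[]-greatest : ∀ {I : Set} {d} (f : I → Carrier) → (∀ i → d ≼ f i) → d ≼ ⋀[ I ] f
  ⋀[]-greatest {d = d} f h = ⋀-greatest _ d (λ { _ (i , refl) → h i })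

  ⋀²-greatest : ∀ {d} (f : Carrier → Carrier → Carrier) → (∀ a b → d ≼ f a b) → d ≼ ⋀² f
  ⋀²-greatest {d} f h = ⋀-greatest _ d (λ { _ (a , b , refl) → h a b })

  ⋀²-lower : ∀ (f : Carrier → Carrier → Carrier) a b → ⋀² f ≼ f a b
  ⋀²-lower f a b = ⋀-lower _ _ (a , b , refl)

  ⋀³-greatest : ∀ {d} (f : Carrier → Carrier → Carrier → Carrier) →
                (∀ a b c → d ≼ f a b c) → d ≼ ⋀³ f
  ⋀³-greatest {d} f h = ⋀-greatest _ d (λ { _ (a , b , c , refl) → h a b c })

  ⋀³-lower : ∀ (f : Carrier → Carrier → Carrier → Carrier) a b c → ⋀³ f ≼ f a b c
  ⋀³-lower f a b c = ⋀-lower _ _ (a , b , c , refl)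

  ⇒-⋀[] : ∀ {I : Set} {d a} (f : I → Carrier) → (∀ i → d ≼ a ⇒ f i) → d ≼ a ⇒ ⋀[ I ] f
  ⇒-⋀[] {d = d} {a} f h = subst (d ≼_) (sym (⇒-⋀ a _))
    (⋀-greatest _ d (λ { _ (_ , (i , refl) , refl) → h i }))

  app-counit : ∀ {a b c} → a ≼ b ⇒ c → app a b ≼ c
  app-counit {a} {b} {c} = ⋀-lower (λ c → a ≼ b ⇒ c) c

  -- Adjunction, unit: a ≼ b ⇒ a b, since b ⇒ (a b) is the meet of all b ⇒ c above a.
  app-unit : ∀ {a b} → a ≼ b ⇒ app a b
  app-unit {a} {b} = subst (a ≼_) (sym (⇒-⋀ b (λ c → a ≼ b ⇒ c)))
    (⋀-greatest _ a (λ { _ (_ , p , refl) → p }))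

  app-unit² : ∀ {a b c} → a ≼ b ⇒ c ⇒ app (app a b) c
  app-unit² = app-unit ∙ ⇒-monotoneʳ app-unit

  app-typing : ∀ {t u a b} → t ≼ a ⇒ b → u ≼ a → app t u ≼ b
  app-typing t≼a⇒b u≼a = app-counit (t≼a⇒b ∙ ⇒-antitoneˡ u≼a)

  lam-typing : ∀ {f a b} → f a ≼ b → lam f ≼ a ⇒ b
  lam-typing {f} {a} fa≼b = ⋀[]-lower (λ c → c ⇒ f c) a ∙ ⇒-monotoneʳ fa≼b

  -- Introducing two and three nested abstractions below a common lower bound d: the
  -- inner abstractions are meets sitting under implications, which ⇒-⋀[] handles.  For
  -- three, the meet ⋀_z (y ⇒ z ⇒ f x y z) is an intermediate bound below y ⇒ λz.f x y z.
  lam²-intro : ∀ {d} (f : Carrier → Carrier → Carrier) →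
               (∀ x y → d ≼ x ⇒ y ⇒ f x y) → d ≼ lam (λ x → lam (λ y → f x y))
  lam²-intro f h = ⋀[]-greatest _ (λ x → ⇒-⋀[] _ (h x))

  lam³-intro : ∀ {d} (f : Carrier → Carrier → Carrier → Carrier) →
               (∀ x y z → d ≼ x ⇒ y ⇒ z ⇒ f x y z) →
               d ≼ lam (λ x → lam (λ y → lam (λ z → f x y z)))
  lam³-intro f h = ⋀[]-greatest _ (λ x → ⇒-⋀[] _ (λ y →
    ⇒-⋀[] (λ z → y ⇒ z ⇒ f x y z) (h x y)
    ∙ ⇒-monotoneʳ (⇒-⋀[] _ (⋀[]-lower (λ z → y ⇒ z ⇒ f x y z)))))

  -- In each, the first argument of antisym is the typing derivation
  -- of the combinator, the second instantiates the type at the parameters: e.g. for W,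
  -- a := y and b := x y y, using x ≼ y ⇒ y ⇒ x y y.
  I-type : I^A ≡ ⋀[ Carrier ] (λ a → a ⇒ a)
  I-type = refl

  K-type : K^A ≡ ⋀² (λ a b → a ⇒ b ⇒ a)
  K-type = antisym
    (⋀²-greatest _ (λ a b → lam-typing (lam-typing ≼-refl)))
    (lam²-intro _ (λ x y → ⋀²-lower _ x y))

  W-type : W^A ≡ ⋀² (λ a b → (a ⇒ a ⇒ b) ⇒ a ⇒ b)
  W-type = antisym
    (⋀²-greatest _ (λ a b → lam-typing (lam-typing
      (app-typing (app-typing ≼-refl ≼-refl) ≼-refl))))
    (lam²-intro _ (λ x y → ⋀²-lower _ y (app (app x y) y) ∙ ⇒-antitoneˡ app-unit²))

  B-type : B^A ≡ ⋀³ (λ a b c → (a ⇒ b) ⇒ (c ⇒ a) ⇒ c ⇒ b)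
  B-type = antisym
    (⋀³-greatest _ (λ a b c → lam-typing (lam-typing (lam-typing
      (app-typing ≼-refl (app-typing ≼-refl ≼-refl))))))
    (lam³-intro _ (λ x y z → ⋀³-lower _ (app y z) (app x (app y z)) z
      ∙ ⇒-antitoneˡ app-unit ∙ ⇒-monotoneʳ (⇒-antitoneˡ app-unit)))

  C-type : C^A ≡ ⋀³ (λ a b c → (a ⇒ b ⇒ c) ⇒ b ⇒ a ⇒ c)
  C-type = antisym
    (⋀³-greatest _ (λ a b c → lam-typing (lam-typing (lam-typing
      (app-typing (app-typing ≼-refl ≼-refl) ≼-refl)))))
    (lam³-intro _ (λ x y z → ⋀³-lower _ z y (app (app x z) y) ∙ ⇒-antitoneˡ app-unit²))

  S-type : S^A ≡ ⋀³ (λ a b c → (a ⇒ b ⇒ c) ⇒ (a ⇒ b) ⇒ a ⇒ c)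
  S-type = antisym
    (⋀³-greatest _ (λ a b c → lam-typing (lam-typing (lam-typing
      (app-typing (app-typing ≼-refl ≼-refl) (app-typing ≼-refl ≼-refl))))))
    (lam³-intro _ (λ x y z → ⋀³-lower _ z (app y z) (app (app x z) (app y z))
      ∙ ⇒-antitoneˡ app-unit² ∙ ⇒-monotoneʳ (⇒-antitoneˡ app-unit)))

proposition2p24 : (𝒜 : ImplicativeStructure) → let open ImplicativeStructure 𝒜 in
    (I^A ≡ ⋀[ Carrier ] (λ a → a ⇒ a))
    × (K^A ≡ ⋀² (λ a b → a ⇒ b ⇒ a))
    × (W^A ≡ ⋀² (λ a b → (a ⇒ a ⇒ b) ⇒ a ⇒ b))
    × (B^A ≡ ⋀³ (λ a b c → (a ⇒ b) ⇒ (c ⇒ a) ⇒ c ⇒ b))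
    × (C^A ≡ ⋀³ (λ a b c → (a ⇒ b ⇒ c) ⇒ b ⇒ a ⇒ c))
    × (S^A ≡ ⋀³ (λ a b c → (a ⇒ b ⇒ c) ⇒ (a ⇒ b) ⇒ a ⇒ c))
proposition2p24 𝒜 = I-type , K-type , W-type , B-type , C-type , S-type
  where open Combinators 𝒜
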